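{- Let $N$ and $k$ be positive integers. Then \[ \sum_{1\leq n_1\leq \cdots \leq n_{k}\leq N} \frac{1}{(n_1+N)n_2\cdots n_{k}} = \begin{cases} \displaystyle{\frac{1}{2}\sum_{1\leq m_1\leq\cdots\leq m_r\leq N} \frac{1}{m_1^2\cdots m_r^2}} &\text{if } k=2r,\\[2ex] \displaystyle{\sum_{1\leq n\leq 2m_1 \leq \cdots\leq 2m_r\leq 2N} \frac{(-1)^{n-1}}{nm_1^2\cdots m_r^2}} &\text{if } k=2r+1, \end{cases} \] all sums being over integers (for $k=1$, i.e. $r=0$, the second sum is $\sum_{n=1}^{2N}(-1)^{n-1}/n$). -}

module Defs where

open import Data.Nat as ℕ using (ℕ; zero; suc; _≤?_)
open import Data.Rational using (ℚ; 0ℚ; 1ℚ; ½; _+_; _*_; -_; _/_)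
open import Data.Integer using (+_)
open import Data.List using (List; map; foldr)
open import Relation.Nullary using (yes; no)

-- Σ_{n=a}^{b} f n  (empty, i.e. 0, when b < a)
Σ[_to_] : ℕ → ℕ → (ℕ → ℚ) → ℚ
Σ[ a to b ] f = go (suc b ℕ.∸ a) a
  where
  go : ℕ → ℕ → ℚ
  go zero    _ = 0ℚ
  go (suc c) i = f i + go c (suc i)

-- chainSum k lo N w = Σ_{lo ≤ n₁ ≤ n₂ ≤ ⋯ ≤ n_k ≤ N} w(n₁) w(n₂) ⋯ w(n_k)
-- (equal to 1 when k = 0: the single empty chain)
chainSum : ℕ → ℕ → ℕ → (ℕ → ℚ) → ℚ
chainSum zero    lo N w = 1ℚ
chainSum (suc k) lo N w = Σ[ lo to N ] (λ n → w n * chainSum k n N w)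

-- 1/n as a rational (n ≥ 1 in all uses; 1/0 is set to 0 but never occurs)
inv : ℕ → ℚ
inv zero    = 0ℚ
inv (suc n) = + 1 / suc n

invSq : ℕ → ℚ
invSq n = inv n * inv n

-- (-1)^(n-1)
sgn : ℕ → ℚ
sgn zero          = - 1ℚ
sgn (suc zero)    = 1ℚ
sgn (suc (suc n)) = sgn n

ind≤ : ℕ → ℕ → ℚ
ind≤ n m with n ≤? m
... | yes _ = 1ℚ
... | no  _ = 0ℚ

lhs : ℕ → ℕ → ℚ
lhs zero    N = 0ℚ   -- k = 0 is excluded by hypothesis
lhs (suc k) N = Σ[ 1 to N ] (λ n₁ → inv (n₁ ℕ.+ N) * chainSum k n₁ N inv)

-- Σ_{1 ≤ m₁ ≤ ⋯ ≤ m_r ≤ N, n ≤ 2 m₁} 1/(m₁² ⋯ m_r²)   (for r = 0: 1)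
chainSumAbove : ℕ → ℕ → ℕ → ℚ
chainSumAbove zero    n N = 1ℚ
chainSumAbove (suc r) n N =
  Σ[ 1 to N ] (λ m₁ → ind≤ n (2 ℕ.* m₁) * invSq m₁ * chainSum r m₁ N invSq)

rhsEven : ℕ → ℕ → ℚ
rhsEven r N = ½ * chainSum r 1 N invSq

rhsOdd : ℕ → ℕ → ℚ
rhsOdd r N = Σ[ 1 to 2 ℕ.* N ] (λ n → sgn n * inv n * chainSumAbove r n N)

{-# OPTIONS --safe #-}
module Submission where

-- Let P(a, b) = ∏_{a ≤ n ≤ N} (1 − t/n)⁻¹ · ∏_{b ≤ n ≤ N} (1 + t/n)⁻¹ and write P_k for the
-- coefficient of tᵏ.  The left-hand side with k + 1 factors is Σ_{a=1}^{N} P_k(a, N+1) / (a + N).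
-- The factor recursions P(a, b) = P(a+1, b) + (t/a) P(a, b) = P(a, b+1) − (t/b) P(a, b), together
-- with 1/a + 1/b = (a + b)/(ab), give
--   P_k(a, b+1) / (a+b) = P_k(a+1, b) / (a+b) + (P_k(a, b) − P_k(a+1, b)) / b,
-- so summing over a ≤ b lowers b by one, up to a telescoping sum and the boundary term
-- P_k(b, b)/(2b−1) − P_k(b+1, b)/(2b).  Going down from b = N + 1 leaves the sum of these
-- boundary terms.  One more factor recursion expresses them through the diagonal series
-- P(c, c) = ∏_{c ≤ n ≤ N} (1 − t²/n²)⁻¹, which is even with the chain sums of 1/n² as
-- coefficients: for k odd only P_{k−1}(c, c)/(2c²) survives, for k even only
-- P_k(c, c) (1/(2c−1) − 1/(2c)).

open import Defs
open import Data.Nat as ℕ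
  using (ℕ; zero; suc; _∸_; _≤_; _<_; _≤‴_; ≤‴-refl; ≤‴-step; z≤n; s≤s)
import Data.Nat.Properties as ℕ
import Data.Integer as ℤ
import Data.Integer.Properties as ℤ
open import Data.Rational using (ℚ; 0ℚ; 1ℚ; ½; _+_; _*_; -_; _-_; _/_; toℚᵘ)
open import Data.Rational.Properties
open import Data.Rational.Unnormalised as ℚᵘ using (mkℚᵘ; *≡*)
import Data.Rational.Unnormalised.Properties as ℚᵘ
open import Data.List using (_∷_; [])
open import Data.Product using (_×_; _,_)
open import Function using (_∘_)
open import Relation.Binary.PropositionalEquality
open import Relation.Nullary using (¬_; yes; no; contradiction)
open import Relation.Nullary.Decidable using (dec⇒maybe)
import Tactic.RingSolver.Core.AlmostCommutativeRing as ACR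
open import Tactic.RingSolver using (solve; solve-∀)

ℚ-ring : ACR.AlmostCommutativeRing _ _
ℚ-ring = ACR.fromCommutativeRing +-*-commutativeRing (λ x → dec⇒maybe (0ℚ ≟ x))

-- Doubling by recursion, so that dbl (suc n) computes to suc (suc (dbl n)).
dbl : ℕ → ℕ
dbl zero    = zero
dbl (suc n) = suc (suc (dbl n))

n+n≡dbl[n] : ∀ n → n ℕ.+ n ≡ dbl n
n+n≡dbl[n] zero    = refl
n+n≡dbl[n] (suc n) = cong suc (trans (ℕ.+-suc n n) (cong suc (n+n≡dbl[n] n)))

2*n≡dbl[n] : ∀ n → 2 ℕ.* n ≡ dbl n
2*n≡dbl[n] n = trans (cong (n ℕ.+_) (ℕ.+-identityʳ n)) (n+n≡dbl[n] n)

fromℕ : ℕ → ℚ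
fromℕ n = ℤ.+ n / 1

fromℕ-+ : ∀ m n → fromℕ (m ℕ.+ n) ≡ fromℕ m + fromℕ n
fromℕ-+ m n = toℚᵘ-injective (begin
  toℚᵘ (fromℕ (m ℕ.+ n))              ≈⟨ toℚᵘ-fromℚᵘ (mkℚᵘ (ℤ.+ (m ℕ.+ n)) 0) ⟩
  mkℚᵘ (ℤ.+ (m ℕ.+ n)) 0               ≈⟨ *≡* (cong (ℤ._* ℤ.+ 1) (trans (ℤ.pos-+ m n) (sym
                                            (cong₂ ℤ._+_ (ℤ.*-identityʳ (ℤ.+ m)) (ℤ.*-identityʳ (ℤ.+ n)))))) ⟩
  mkℚᵘ (ℤ.+ m) 0 ℚᵘ.+ mkℚᵘ (ℤ.+ n) 0   ≈⟨ ℚᵘ.≃-sym (ℚᵘ.+-cong (toℚᵘ-fromℚᵘ (mkℚᵘ (ℤ.+ m) 0))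
                                                               (toℚᵘ-fromℚᵘ (mkℚᵘ (ℤ.+ n) 0))) ⟩
  toℚᵘ (fromℕ m) ℚᵘ.+ toℚᵘ (fromℕ n)   ≈⟨ ℚᵘ.≃-sym (toℚᵘ-homo-+ (fromℕ m) (fromℕ n)) ⟩
  toℚᵘ (fromℕ m + fromℕ n)             ∎)
  where open ℚᵘ.≃-Reasoning

inv-inverseˡ : ∀ n → inv (suc n) * fromℕ (suc n) ≡ 1ℚ
inv-inverseˡ n = toℚᵘ-injective (begin
  toℚᵘ (inv (suc n) * fromℕ (suc n))            ≈⟨ toℚᵘ-homo-* (inv (suc n)) (fromℕ (suc n)) ⟩
  toℚᵘ (inv (suc n)) ℚᵘ.* toℚᵘ (fromℕ (suc n))  ≈⟨ ℚᵘ.*-cong (toℚᵘ-fromℚᵘ (mkℚᵘ (ℤ.+ 1) n))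
                                                              (toℚᵘ-fromℚᵘ (mkℚᵘ (ℤ.+ suc n) 0)) ⟩
  mkℚᵘ (ℤ.+ 1) n ℚᵘ.* mkℚᵘ (ℤ.+ suc n) 0        ≈⟨ ℚᵘ.*-inverseˡ (mkℚᵘ (ℤ.+ suc n) 0) ⟩
  ℚᵘ.1ℚᵘ                                        ∎)
  where open ℚᵘ.≃-Reasoning

reciprocal-+ : ∀ x y z {A B : ℚ} → x * A ≡ 1ℚ → y * B ≡ 1ℚ → z * (A + B) ≡ 1ℚ →
               (x + y) * z ≡ x * y
reciprocal-+ x y z {A} {B} xA≡1 yB≡1 z[A+B]≡1 = begin
  (x + y) * z                      ≡⟨ solve (x ∷ y ∷ z ∷ []) ℚ-ring ⟩
  (x * 1ℚ + y * 1ℚ) * z            ≡⟨ cong₂ (λ s t → (x * s + y * t) * z) (sym yB≡1) (sym xA≡1) ⟩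
  (x * (y * B) + y * (x * A)) * z  ≡⟨ solve (x ∷ y ∷ z ∷ A ∷ B ∷ []) ℚ-ring ⟩
  x * y * (z * (A + B))            ≡⟨ cong (x * y *_) z[A+B]≡1 ⟩
  x * y * 1ℚ                       ≡⟨ *-identityʳ (x * y) ⟩
  x * y                            ∎
  where open ≡-Reasoning

reciprocal-unique : ∀ {z z′ A : ℚ} → z * A ≡ 1ℚ → z′ * A ≡ 1ℚ → z ≡ z′
reciprocal-unique {z} {z′} {A} zA≡1 z′A≡1 = begin
  z             ≡⟨ solve (z ∷ []) ℚ-ring ⟩
  z * 1ℚ        ≡⟨ cong (z *_) (sym z′A≡1) ⟩
  z * (z′ * A)  ≡⟨ solve (z ∷ z′ ∷ A ∷ []) ℚ-ring ⟩
  z′ * (z * A)  ≡⟨ cong (z′ *_) zA≡1 ⟩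
  z′ * 1ℚ       ≡⟨ *-identityʳ z′ ⟩
  z′            ∎
  where open ≡-Reasoning

inv-+ : ∀ a b → (inv (suc a) + inv (suc b)) * inv (suc a ℕ.+ suc b) ≡ inv (suc a) * inv (suc b)
inv-+ a b = reciprocal-+ (inv (suc a)) (inv (suc b)) (inv (suc a ℕ.+ suc b))
  (inv-inverseˡ a) (inv-inverseˡ b)
  (trans (cong (inv (suc a ℕ.+ suc b) *_) (sym (fromℕ-+ (suc a) (suc b)))) (inv-inverseˡ (a ℕ.+ suc b)))

inv-dbl : ∀ n → inv (dbl (suc n)) ≡ ½ * inv (suc n)
inv-dbl n = reciprocal-unique {A = A + A} w[A+A]≡1 (trans (halve (inv (suc n)) A) (inv-inverseˡ n))
  where
  A = fromℕ (suc n)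
  halve : ∀ x A → ½ * x * (A + A) ≡ x * A
  halve = solve-∀ ℚ-ring
  w[A+A]≡1 : inv (dbl (suc n)) * (A + A) ≡ 1ℚ
  w[A+A]≡1 = begin
    inv (dbl (suc n)) * (A + A)                  ≡⟨ cong (inv (dbl (suc n)) *_) (sym (fromℕ-+ (suc n) (suc n))) ⟩
    inv (dbl (suc n)) * fromℕ (suc n ℕ.+ suc n)  ≡⟨ cong (λ m → inv (dbl (suc n)) * fromℕ m) (n+n≡dbl[n] (suc n)) ⟩
    inv (dbl (suc n)) * fromℕ (dbl (suc n))      ≡⟨ inv-inverseˡ (suc (dbl n)) ⟩
    1ℚ                                           ∎
    where open ≡-Reasoning

sumFrom : ℕ → ℕ → (ℕ → ℚ) → ℚ
sumFrom i zero    f = 0ℚ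
sumFrom i (suc n) f = f i + sumFrom (suc i) n f

Σ-cons : ∀ {a b} f → a ≤ b → Σ[ a to b ] f ≡ f a + Σ[ suc a to b ] f
Σ-cons {a} {b} f a≤b with suc b ∸ a | ℕ.+-∸-assoc 1 a≤b
... | .(suc (b ∸ a)) | refl = refl

Σ-empty : ∀ b f → Σ[ suc b to b ] f ≡ 0ℚ
Σ-empty b f with b ∸ b | ℕ.n∸n≡0 b
... | .0 | refl = refl

Σ≡sumFrom : ∀ n {a b} f → n ℕ.+ a ≡ suc b → Σ[ a to b ] f ≡ sumFrom a n f
Σ≡sumFrom zero    {b = b} f refl = Σ-empty b f
Σ≡sumFrom (suc n) {a}     f n+1+a≡1+b =
  trans (Σ-cons f (ℕ.≤-pred a<1+b)) (cong (f a +_) (Σ≡sumFrom n f (trans (ℕ.+-suc n a) n+1+a≡1+b)))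
  where
  a<1+b : a < suc _
  a<1+b = subst (a <_) n+1+a≡1+b (ℕ.m<n+m a (s≤s z≤n))

Σ[1to]≡sumFrom : ∀ n f → Σ[ 1 to n ] f ≡ sumFrom 1 n f
Σ[1to]≡sumFrom n f = Σ≡sumFrom n f (ℕ.+-comm n 1)

sumFrom-cong : ∀ i n {f g : ℕ → ℚ} → (∀ j → i ≤ j → j < i ℕ.+ n → f j ≡ g j) →
               sumFrom i n f ≡ sumFrom i n g
sumFrom-cong i zero    f≗g = refl
sumFrom-cong i (suc n) f≗g = cong₂ _+_ (f≗g i ℕ.≤-refl (ℕ.m<m+n i (s≤s z≤n)))
  (sumFrom-cong (suc i) n (λ j i<j j<1+i+n → f≗g j (ℕ.<⇒≤ i<j) (subst (j <_) (sym (ℕ.+-suc i n)) j<1+i+n)))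

sumFrom-snoc : ∀ i n f → sumFrom i (suc n) f ≡ sumFrom i n f + f (i ℕ.+ n)
sumFrom-snoc i zero    f = trans (+-identityʳ (f i)) (trans (cong f (sym (ℕ.+-identityʳ i))) (sym (+-identityˡ _)))
sumFrom-snoc i (suc n) f = begin
  f i + sumFrom (suc i) (suc n) f                ≡⟨ cong (f i +_) (sumFrom-snoc (suc i) n f) ⟩
  f i + (sumFrom (suc i) n f + f (suc i ℕ.+ n))  ≡⟨ sym (+-assoc (f i) _ _) ⟩
  sumFrom i (suc n) f + f (suc i ℕ.+ n)          ≡⟨ cong (λ j → sumFrom i (suc n) f + f j) (sym (ℕ.+-suc i n)) ⟩
  sumFrom i (suc n) f + f (i ℕ.+ suc n)          ∎
  where open ≡-Reasoning

sumFrom-suc : ∀ i n f → sumFrom (suc i) n f ≡ sumFrom i n (f ∘ suc)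
sumFrom-suc i zero    f = refl
sumFrom-suc i (suc n) f = cong (f (suc i) +_) (sumFrom-suc (suc i) n f)

sumFrom-+ : ∀ i n f g → sumFrom i n (λ j → f j + g j) ≡ sumFrom i n f + sumFrom i n g
sumFrom-+ i zero    f g = sym (+-identityˡ 0ℚ)
sumFrom-+ i (suc n) f g = trans (cong (f i + g i +_) (sumFrom-+ (suc i) n f g))
  (+-interchange (f i) (g i) (sumFrom (suc i) n f) (sumFrom (suc i) n g))
  where
  +-interchange : ∀ a b c d → a + b + (c + d) ≡ a + c + (b + d)
  +-interchange = solve-∀ ℚ-ring

sumFrom-*ˡ : ∀ i n x f → sumFrom i n (λ j → x * f j) ≡ x * sumFrom i n f
sumFrom-*ˡ i zero    x f = sym (*-zeroʳ x)
sumFrom-*ˡ i (suc n) x f = trans (cong (x * f i +_) (sumFrom-*ˡ (suc i) n x f)) (sym (*-distribˡ-+ x (f i) _))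

sumFrom-telescope : ∀ i n (f : ℕ → ℚ) → sumFrom i n (λ j → f j - f (suc j)) ≡ f i - f (i ℕ.+ n)
sumFrom-telescope i zero    f = trans (sym (+-inverseʳ (f i))) (cong (λ j → f i - f j) (sym (ℕ.+-identityʳ i)))
sumFrom-telescope i (suc n) f = begin
  f i - f (suc i) + sumFrom (suc i) n (λ j → f j - f (suc j))  ≡⟨ cong (f i - f (suc i) +_) (sumFrom-telescope (suc i) n f) ⟩
  f i - f (suc i) + (f (suc i) - f (suc i ℕ.+ n))              ≡⟨ cancel (f i) (f (suc i)) (f (suc i ℕ.+ n)) ⟩
  f i - f (suc i ℕ.+ n)                                        ≡⟨ cong (λ j → f i - f j) (sym (ℕ.+-suc i n)) ⟩
  f i - f (i ℕ.+ suc n)                                        ∎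
  where
  open ≡-Reasoning
  cancel : ∀ a b c → a - b + (b - c) ≡ a - c
  cancel = solve-∀ ℚ-ring

sumFrom-dbl : ∀ i n f →
  sumFrom (suc (dbl i)) (dbl n) f ≡ sumFrom (suc i) n (λ j → f (ℕ.pred (dbl j)) + f (dbl j))
sumFrom-dbl i zero    f = refl
sumFrom-dbl i (suc n) f = trans (sym (+-assoc (f (suc (dbl i))) (f (dbl (suc i))) _))
  (cong (f (suc (dbl i)) + f (dbl (suc i)) +_) (sumFrom-dbl (suc i) n f))

sumFrom-skip-zeros : ∀ i m d f → (∀ j → j < i ℕ.+ m → f j ≡ 0ℚ) →
                     sumFrom i (m ℕ.+ d) f ≡ sumFrom (i ℕ.+ m) d f
sumFrom-skip-zeros i zero    d f f≡0 = cong (λ j → sumFrom j d f) (sym (ℕ.+-identityʳ i))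
sumFrom-skip-zeros i (suc m) d f f≡0 = begin
  f i + sumFrom (suc i) (m ℕ.+ d) f  ≡⟨ cong₂ _+_ (f≡0 i (ℕ.m<m+n i (s≤s z≤n))) (sumFrom-skip-zeros (suc i) m d f
                                          (λ j j<1+i+m → f≡0 j (subst (j <_) (sym (ℕ.+-suc i m)) j<1+i+m))) ⟩
  0ℚ + sumFrom (suc i ℕ.+ m) d f     ≡⟨ +-identityˡ _ ⟩
  sumFrom (suc i ℕ.+ m) d f          ≡⟨ cong (λ j → sumFrom j d f) (sym (ℕ.+-suc i m)) ⟩
  sumFrom (i ℕ.+ suc m) d f          ∎
  where open ≡-Reasoning

Series : Set
Series = ℕ → ℚ

infixl 7 _⋆_
_⋆_ : Series → Series → Series
(f ⋆ g) zero    = f 0 * g 0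
(f ⋆ g) (suc k) = f 0 * g (suc k) + ((f ∘ suc) ⋆ g) k

shift : Series → Series
shift f zero    = 0ℚ
shift f (suc k) = f k

one : Series
one zero    = 1ℚ
one (suc k) = 0ℚ

-- f · (1 − x t) = f′, coefficientwise.
infix 4 _*[1-_t]≡_
_*[1-_t]≡_ : Series → ℚ → Series → Set
f *[1- x t]≡ f′ = ∀ k → f k ≡ f′ k + x * shift f k

⋆-cong : ∀ {f f′ g g′} → f ≗ f′ → g ≗ g′ → f ⋆ g ≗ f′ ⋆ g′
⋆-cong f≗f′ g≗g′ zero    = cong₂ _*_ (f≗f′ 0) (g≗g′ 0)
⋆-cong f≗f′ g≗g′ (suc k) = cong₂ _+_ (cong₂ _*_ (f≗f′ 0) (g≗g′ (suc k))) (⋆-cong (f≗f′ ∘ suc) g≗g′ k)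

⋆-distribʳ-+ : ∀ f f′ g → (λ i → f i + f′ i) ⋆ g ≗ (λ k → (f ⋆ g) k + (f′ ⋆ g) k)
⋆-distribʳ-+ f f′ g zero    = *-distribʳ-+ (g 0) (f 0) (f′ 0)
⋆-distribʳ-+ f f′ g (suc k) =
  trans (cong ((f 0 + f′ 0) * g (suc k) +_) (⋆-distribʳ-+ (f ∘ suc) (f′ ∘ suc) g k))
        (regroup (f 0) (f′ 0) (g (suc k)) _ _)
  where
  regroup : ∀ a b x c d → (a + b) * x + (c + d) ≡ (a * x + c) + (b * x + d)
  regroup = solve-∀ ℚ-ring

⋆-distribˡ-+ : ∀ f g g′ → f ⋆ (λ i → g i + g′ i) ≗ (λ k → (f ⋆ g) k + (f ⋆ g′) k)
⋆-distribˡ-+ f g g′ zero    = *-distribˡ-+ (f 0) (g 0) (g′ 0)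
⋆-distribˡ-+ f g g′ (suc k) =
  trans (cong (f 0 * (g (suc k) + g′ (suc k)) +_) (⋆-distribˡ-+ (f ∘ suc) g g′ k))
        (regroup (f 0) (g (suc k)) (g′ (suc k)) _ _)
  where
  regroup : ∀ x a b c d → x * (a + b) + (c + d) ≡ (x * a + c) + (x * b + d)
  regroup = solve-∀ ℚ-ring

⋆-*ˡ : ∀ x f g → (λ i → x * f i) ⋆ g ≗ (λ k → x * (f ⋆ g) k)
⋆-*ˡ x f g zero    = *-assoc x (f 0) (g 0)
⋆-*ˡ x f g (suc k) = trans (cong (x * f 0 * g (suc k) +_) (⋆-*ˡ x (f ∘ suc) g k)) (regroup x (f 0) (g (suc k)) _)
  where
  regroup : ∀ x a b c → x * a * b + x * c ≡ x * (a * b + c)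
  regroup = solve-∀ ℚ-ring

⋆-*ʳ : ∀ x f g → f ⋆ (λ i → x * g i) ≗ (λ k → x * (f ⋆ g) k)
⋆-*ʳ x f g zero    = regroup x (f 0) (g 0)
  where
  regroup : ∀ x a b → a * (x * b) ≡ x * (a * b)
  regroup = solve-∀ ℚ-ring
⋆-*ʳ x f g (suc k) = trans (cong (f 0 * (x * g (suc k)) +_) (⋆-*ʳ x (f ∘ suc) g k)) (regroup x (f 0) (g (suc k)) _)
  where
  regroup : ∀ x a b c → a * (x * b) + x * c ≡ x * (a * b + c)
  regroup = solve-∀ ℚ-ring

⋆-shiftˡ : ∀ f g → shift f ⋆ g ≗ shift (f ⋆ g)
⋆-shiftˡ f g zero    = *-zeroˡ (g 0)
⋆-shiftˡ f g (suc k) = trans (cong (_+ (f ⋆ g) k) (*-zeroˡ (g (suc k)))) (+-identityˡ _)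

⋆-shiftʳ : ∀ f g → f ⋆ shift g ≗ shift (f ⋆ g)
⋆-shiftʳ f g zero          = *-zeroʳ (f 0)
⋆-shiftʳ f g (suc zero)    = trans (cong (f 0 * g 0 +_) (*-zeroʳ (f 1))) (+-identityʳ _)
⋆-shiftʳ f g (suc (suc k)) = cong (f 0 * g (suc k) +_) (⋆-shiftʳ (f ∘ suc) g (suc k))

⋆-identityʳ : ∀ f → f ⋆ one ≗ f
⋆-identityʳ f zero    = *-identityʳ (f 0)
⋆-identityʳ f (suc k) = trans (cong (_+ ((f ∘ suc) ⋆ one) k) (*-zeroʳ (f 0)))
  (trans (+-identityˡ _) (⋆-identityʳ (f ∘ suc) k))

⋆-stepˡ : ∀ {f f′ x} g → f *[1- x t]≡ f′ → f ⋆ g *[1- x t]≡ f′ ⋆ g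
⋆-stepˡ {f} {f′} {x} g f-step k = begin
  (f ⋆ g) k                                   ≡⟨ ⋆-cong f-step (λ _ → refl) k ⟩
  ((λ i → f′ i + x * shift f i) ⋆ g) k        ≡⟨ ⋆-distribʳ-+ f′ _ g k ⟩
  (f′ ⋆ g) k + ((λ i → x * shift f i) ⋆ g) k  ≡⟨ cong ((f′ ⋆ g) k +_) (⋆-*ˡ x (shift f) g k) ⟩
  (f′ ⋆ g) k + x * (shift f ⋆ g) k            ≡⟨ cong (λ s → (f′ ⋆ g) k + x * s) (⋆-shiftˡ f g k) ⟩
  (f′ ⋆ g) k + x * shift (f ⋆ g) k            ∎
  where open ≡-Reasoning

⋆-stepʳ : ∀ {g g′ x} f → g *[1- x t]≡ g′ → f ⋆ g *[1- x t]≡ f ⋆ g′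
⋆-stepʳ {g} {g′} {x} f g-step k = begin
  (f ⋆ g) k                                   ≡⟨ ⋆-cong (λ _ → refl) g-step k ⟩
  (f ⋆ (λ i → g′ i + x * shift g i)) k        ≡⟨ ⋆-distribˡ-+ f g′ _ k ⟩
  (f ⋆ g′) k + (f ⋆ (λ i → x * shift g i)) k  ≡⟨ cong ((f ⋆ g′) k +_) (⋆-*ʳ x f (shift g) k) ⟩
  (f ⋆ g′) k + x * (f ⋆ shift g) k            ≡⟨ cong (λ s → (f ⋆ g′) k + x * s) (⋆-shiftʳ f g k) ⟩
  (f ⋆ g′) k + x * shift (f ⋆ g) k            ∎
  where open ≡-Reasoning

-- ∏_{lo ≤ n ≤ N} (1 − w n · t)⁻¹
chainSeries : (ℕ → ℚ) → ℕ → ℕ → Series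
chainSeries w lo N k = chainSum k lo N w

chainSeries-step : ∀ w {lo} {N} → lo ≤ N → chainSeries w lo N *[1- w lo t]≡ chainSeries w (suc lo) N
chainSeries-step w {lo}      lo≤N zero    = sym (trans (cong (1ℚ +_) (*-zeroʳ (w lo))) (+-identityʳ 1ℚ))
chainSeries-step w {lo} {N} lo≤N (suc k) = trans (Σ-cons _ lo≤N) (+-comm (w lo * chainSum k lo N w) _)

chainSeries-top : ∀ w N → chainSeries w (suc N) N ≗ one
chainSeries-top w N zero    = refl
chainSeries-top w N (suc k) = Σ-empty N _

module Product (N : ℕ) (u : ℕ → ℚ) where

  -- ∏_{a ≤ n ≤ N} (1 − u n · t)⁻¹ · ∏_{b ≤ n ≤ N} (1 + u n · t)⁻¹
  P : ℕ → ℕ → Series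
  P a b = chainSeries u a N ⋆ chainSeries (λ n → - u n) b N

  P-stepˡ : ∀ {a} b → a ≤ N → P a b *[1- u a t]≡ P (suc a) b
  P-stepˡ {a} b a≤N = ⋆-stepˡ {x = u a} (chainSeries (λ n → - u n) b N) (chainSeries-step u a≤N)

  P-stepʳ : ∀ a {b} → b ≤ N → P a b *[1- - u b t]≡ P a (suc b)
  P-stepʳ a {b} b≤N = ⋆-stepʳ {x = - u b} (chainSeries u a N) (chainSeries-step (λ n → - u n) b≤N)

  P-top : ∀ a → P a (suc N) ≗ chainSeries u a N
  P-top a k = trans (⋆-cong (λ _ → refl) (chainSeries-top _ N) k) (⋆-identityʳ _ k)

  P-top-top : P (suc N) (suc N) ≗ one
  P-top-top k = trans (P-top (suc N) k) (chainSeries-top u N k)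

  P-diag-step : ∀ {c} → c ≤ N → ∀ k → P c c k ≡ P (suc c) (suc c) k + u c * u c * shift (shift (P c c)) k
  P-diag-step {c} c≤N zero    = begin
    P c c 0                                        ≡⟨ P-stepˡ c c≤N 0 ⟩
    P (suc c) c 0 + u c * 0ℚ                       ≡⟨ cong (_+ u c * 0ℚ) (P-stepʳ (suc c) c≤N 0) ⟩
    P (suc c) (suc c) 0 + (- u c) * 0ℚ + u c * 0ℚ  ≡⟨ regroup (P (suc c) (suc c) 0) (u c) ⟩
    P (suc c) (suc c) 0 + u c * u c * 0ℚ           ∎
    where
    open ≡-Reasoning
    regroup : ∀ a x → a + (- x) * 0ℚ + x * 0ℚ ≡ a + x * x * 0ℚ
    regroup = solve-∀ ℚ-ring
  P-diag-step {c} c≤N (suc k) = begin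
    P c c (suc k)
      ≡⟨ P-stepˡ c c≤N (suc k) ⟩
    P (suc c) c (suc k) + u c * P c c k
      ≡⟨ cong₂ (λ s t → s + u c * t) (P-stepʳ (suc c) c≤N (suc k)) (P-stepˡ c c≤N k) ⟩
    P (suc c) (suc c) (suc k) + (- u c) * P (suc c) c k + u c * (P (suc c) c k + u c * shift (P c c) k)
      ≡⟨ regroup (P (suc c) (suc c) (suc k)) (P (suc c) c k) (u c) (shift (P c c) k) ⟩
    P (suc c) (suc c) (suc k) + u c * u c * shift (P c c) k
      ∎
    where
    open ≡-Reasoning
    regroup : ∀ a b x s → a + (- x) * b + x * (b + x * s) ≡ a + x * x * s
    regroup = solve-∀ ℚ-ring

  P-diag-odd : ∀ r {c} → c ≤‴ suc N → P c c (suc (dbl r)) ≡ 0ℚ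
  P-diag-odd r     ≤‴-refl           = P-top-top (suc (dbl r))
  P-diag-odd r {c} (≤‴-step c<‴1+N) = begin
    P c c (suc (dbl r))
      ≡⟨ P-diag-step c≤N (suc (dbl r)) ⟩
    P (suc c) (suc c) (suc (dbl r)) + u c * u c * shift (shift (P c c)) (suc (dbl r))
      ≡⟨ cong₂ (λ s t → s + u c * u c * t) (P-diag-odd r c<‴1+N) (below r) ⟩
    0ℚ + u c * u c * 0ℚ
      ≡⟨ trans (+-identityˡ _) (*-zeroʳ (u c * u c)) ⟩
    0ℚ
      ∎
    where
    open ≡-Reasoning
    c≤N = ℕ.≤-pred (ℕ.≤‴⇒≤ c<‴1+N)
    below : ∀ r → shift (shift (P c c)) (suc (dbl r)) ≡ 0ℚ
    below zero    = refl
    below (suc r) = P-diag-odd r (≤‴-step c<‴1+N)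

  P-diag-even : ∀ r {c} → c ≤‴ suc N → P c c (dbl r) ≡ chainSum r c N (λ n → u n * u n)
  P-diag-even zero    ≤‴-refl = P-top-top 0
  P-diag-even (suc r) ≤‴-refl = trans (P-top-top (dbl (suc r))) (sym (chainSeries-top (λ n → u n * u n) N (suc r)))
  P-diag-even r {c} (≤‴-step c<‴1+N) = begin
    P c c (dbl r)
      ≡⟨ P-diag-step c≤N (dbl r) ⟩
    P (suc c) (suc c) (dbl r) + u c * u c * shift (shift (P c c)) (dbl r)
      ≡⟨ cong₂ (λ s t → s + u c * u c * t) (P-diag-even r c<‴1+N) (below r) ⟩
    chainSum r (suc c) N u² + u c * u c * shift (chainSeries u² c N) r
      ≡⟨ sym (chainSeries-step u² c≤N r) ⟩
    chainSum r c N u²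
      ∎
    where
    open ≡-Reasoning
    u² = λ n → u n * u n
    c≤N = ℕ.≤-pred (ℕ.≤‴⇒≤ c<‴1+N)
    below : ∀ r → shift (shift (P c c)) (dbl r) ≡ shift (chainSeries u² c N) r
    below zero    = refl
    below (suc r) = P-diag-even r (≤‴-step c<‴1+N)

eliminate-shift : ∀ {A B C Z} x y z → A ≡ B + x * Z → A ≡ C + (- y) * Z → (x + y) * z ≡ x * y →
                  C * z ≡ B * z + y * (A - B)
eliminate-shift {A} {B} {C} {Z} x y z A≡B+xZ A≡C-yZ [x+y]z≡xy = begin
  C * z                        ≡⟨ solve (C ∷ Z ∷ y ∷ z ∷ []) ℚ-ring ⟩
  (C + (- y) * Z + y * Z) * z  ≡⟨ cong (λ s → (s + y * Z) * z) (sym A≡C-yZ) ⟩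
  (A + y * Z) * z              ≡⟨ cong (λ s → (s + y * Z) * z) A≡B+xZ ⟩
  (B + x * Z + y * Z) * z      ≡⟨ solve (B ∷ Z ∷ x ∷ y ∷ z ∷ []) ℚ-ring ⟩
  B * z + Z * ((x + y) * z)    ≡⟨ cong (λ s → B * z + Z * s) [x+y]z≡xy ⟩
  B * z + Z * (x * y)          ≡⟨ solve (B ∷ Z ∷ x ∷ y ∷ z ∷ []) ℚ-ring ⟩
  B * z + y * (B + x * Z - B)  ≡⟨ cong (λ s → B * z + y * (s - B)) (sym A≡B+xZ) ⟩
  B * z + y * (A - B)          ∎
  where open ≡-Reasoning

module Telescoping (N k : ℕ) where
  open Product N inv

  term : ℕ → ℕ → ℚ
  term m a = P a (suc m) k * inv (a ℕ.+ m)

  partial : ℕ → ℚ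
  partial m = sumFrom 1 m (term m)

  boundary : ℕ → ℚ
  boundary c = P c c k * inv (ℕ.pred (dbl c)) - P (suc c) c k * inv (dbl c)

  term-suc : ∀ {a m} → suc a ≤ N → suc m ≤ N →
    term (suc m) (suc a) ≡ term m (suc (suc a)) + inv (suc m) * (P (suc a) (suc m) k - P (suc (suc a)) (suc m) k)
  term-suc {a} {m} a<N m<N = trans
    (eliminate-shift {B = B} {C = P (suc a) (suc (suc m)) k} {Z = shift (P (suc a) (suc m)) k}
       (inv (suc a)) y (inv (suc a ℕ.+ suc m))
       (P-stepˡ (suc m) a<N k) (P-stepʳ (suc a) m<N k) (inv-+ a m))
    (cong (λ n → B * inv (suc n) + y * (P (suc a) (suc m) k - B)) (ℕ.+-suc a m))
    where
    B = P (suc (suc a)) (suc m) k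
    y = inv (suc m)

  partial-suc : ∀ {m} → suc m ≤ N → partial (suc m) ≡ partial m + boundary (suc m)
  partial-suc {m} m<N = begin
    sumFrom 1 M (term M)
      ≡⟨ sumFrom-cong 1 M term-expand ⟩
    sumFrom 1 M (λ a → g (suc a) + x * (Q a - Q (suc a)))
      ≡⟨ sumFrom-+ 1 M (g ∘ suc) _ ⟩
    sumFrom 1 M (g ∘ suc) + sumFrom 1 M (λ a → x * (Q a - Q (suc a)))
      ≡⟨ cong₂ _+_ (sym (sumFrom-suc 1 M g)) (trans (sumFrom-*ˡ 1 M x _) (cong (x *_) (sumFrom-telescope 1 M Q))) ⟩
    sumFrom 2 M g + x * (Q 1 - Q (suc M))
      ≡⟨ move-first (sumFrom 2 M g) (Q 1) (Q (suc M)) x ⟩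
    sumFrom 1 (suc M) g - x * Q (suc M)
      ≡⟨ cong (_- x * Q (suc M)) (trans (sumFrom-snoc 1 M g) (cong (_+ g (suc M)) (sumFrom-snoc 1 m g))) ⟩
    partial m + P M M k * inv (suc (m ℕ.+ m)) + Q (suc M) * inv (suc (suc (m ℕ.+ m))) - x * Q (suc M)
      ≡⟨ cong (λ n → partial m + P M M k * inv (suc n) + Q (suc M) * inv (suc (suc n)) - x * Q (suc M)) (n+n≡dbl[n] m) ⟩
    partial m + P M M k * inv (ℕ.pred (dbl M)) + Q (suc M) * w - x * Q (suc M)
      ≡⟨ cong (λ s → partial m + P M M k * inv (ℕ.pred (dbl M)) + Q (suc M) * w - s * Q (suc M)) x≡w+w ⟩
    partial m + P M M k * inv (ℕ.pred (dbl M)) + Q (suc M) * w - (w + w) * Q (suc M)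
      ≡⟨ regroup (partial m) (P M M k * inv (ℕ.pred (dbl M))) (Q (suc M)) w ⟩
    partial m + boundary M
      ∎
    where
    open ≡-Reasoning
    M = suc m
    g = term m
    Q = λ a → P a M k
    x = inv M
    w = inv (dbl M)
    term-expand : ∀ a → 1 ≤ a → a < 1 ℕ.+ M → term M a ≡ g (suc a) + x * (Q a - Q (suc a))
    term-expand (suc a) _ a<M = term-suc (ℕ.≤-trans (ℕ.≤-pred a<M) m<N) m<N
    halves : ∀ x → x ≡ ½ * x + ½ * x
    halves = solve-∀ ℚ-ring
    x≡w+w : x ≡ w + w
    x≡w+w = trans (halves x) (cong (λ s → s + s) (sym (inv-dbl m)))
    move-first : ∀ S q₁ q₂ x → S + x * (q₁ - q₂) ≡ q₁ * x + S - x * q₂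
    move-first = solve-∀ ℚ-ring
    regroup : ∀ X a b w → X + a + b * w - (w + w) * b ≡ X + (a - b * w)
    regroup = solve-∀ ℚ-ring

  partial≡Σboundary : ∀ {m} → m ≤ N → partial m ≡ sumFrom 1 m boundary
  partial≡Σboundary {zero}  _   = refl
  partial≡Σboundary {suc m} m<N = begin
    partial (suc m)                          ≡⟨ partial-suc m<N ⟩
    partial m + boundary (suc m)             ≡⟨ cong (_+ boundary (suc m)) (partial≡Σboundary (ℕ.<⇒≤ m<N)) ⟩
    sumFrom 1 m boundary + boundary (suc m)  ≡⟨ sym (sumFrom-snoc 1 m boundary) ⟩
    sumFrom 1 (suc m) boundary               ∎
    where open ≡-Reasoning

  lhs≡Σboundary : lhs (suc k) N ≡ sumFrom 1 N boundary
  lhs≡Σboundary = begin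
    lhs (suc k) N                                           ≡⟨ Σ[1to]≡sumFrom N _ ⟩
    sumFrom 1 N (λ a → inv (a ℕ.+ N) * chainSum k a N inv)  ≡⟨ sumFrom-cong 1 N (λ a _ _ →
      trans (*-comm (inv (a ℕ.+ N)) _) (cong (_* inv (a ℕ.+ N)) (sym (P-top a k)))) ⟩
    partial N                                               ≡⟨ partial≡Σboundary ℕ.≤-refl ⟩
    sumFrom 1 N boundary                                    ∎
    where open ≡-Reasoning

  boundary-diag : ∀ {c} → suc c ≤ N →
    boundary (suc c) ≡ P (suc c) (suc c) k * (inv (suc (dbl c)) - inv (dbl (suc c)))
                         + ½ * invSq (suc c) * shift (P (suc c) (suc c)) k
  boundary-diag {c} c<N = begin
    A * inv (suc (dbl c)) - B * inv (dbl (suc c))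
      ≡⟨ cong (λ s → A * inv (suc (dbl c)) - B * s) (inv-dbl c) ⟩
    A * inv (suc (dbl c)) - B * (½ * x)
      ≡⟨ rearrange {B = B} {Z = Z} {x = x} (inv (suc (dbl c))) (P-stepˡ (suc c) c<N k) ⟩
    A * (inv (suc (dbl c)) - ½ * x) + ½ * (x * x) * Z
      ≡⟨ cong (λ s → A * (inv (suc (dbl c)) - s) + ½ * (x * x) * Z) (sym (inv-dbl c)) ⟩
    A * (inv (suc (dbl c)) - inv (dbl (suc c))) + ½ * (x * x) * Z
      ∎
    where
    open ≡-Reasoning
    A = P (suc c) (suc c) k
    B = P (suc (suc c)) (suc c) k
    Z = shift (P (suc c) (suc c)) k
    x = inv (suc c)
    rearrange : ∀ {A B Z x} i → A ≡ B + x * Z → A * i - B * (½ * x) ≡ A * (i - ½ * x) + ½ * (x * x) * Z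
    rearrange {A} {B} {Z} {x} i A≡B+xZ = begin
      A * i - B * (½ * x)                              ≡⟨ solve (A ∷ B ∷ Z ∷ x ∷ i ∷ []) ℚ-ring ⟩
      A * i - (B + x * Z) * (½ * x) + ½ * (x * x) * Z  ≡⟨ cong (λ s → A * i - s * (½ * x) + ½ * (x * x) * Z) (sym A≡B+xZ) ⟩
      A * i - A * (½ * x) + ½ * (x * x) * Z            ≡⟨ solve (A ∷ Z ∷ x ∷ i ∷ []) ℚ-ring ⟩
      A * (i - ½ * x) + ½ * (x * x) * Z                ∎

ind≤-yes : ∀ {n m} → n ≤ m → ind≤ n m ≡ 1ℚ
ind≤-yes {n} {m} n≤m with n ℕ.≤? m
... | yes _   = refl
... | no  n≰m = contradiction n≤m n≰m

ind≤-no : ∀ {n m} → ¬ n ≤ m → ind≤ n m ≡ 0ℚ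
ind≤-no {n} {m} n≰m with n ℕ.≤? m
... | yes n≤m = contradiction n≤m n≰m
... | no  _   = refl

sgn-odd : ∀ m → sgn (suc (dbl m)) ≡ 1ℚ
sgn-odd zero    = refl
sgn-odd (suc m) = sgn-odd m

sgn-even : ∀ m → sgn (dbl (suc m)) ≡ - 1ℚ
sgn-even zero    = refl
sgn-even (suc m) = sgn-even m

chainSumAbove-pair : ∀ r {m n N} → suc m ≤ N → suc (dbl m) ≤ n → n ≤ dbl (suc m) →
                     chainSumAbove r n N ≡ chainSum r (suc m) N invSq
chainSumAbove-pair zero    _ _ _ = refl
chainSumAbove-pair (suc r) {m} {n} {N} m<N 2m<n n≤2m+2 = begin
  Σ[ 1 to N ] F                ≡⟨ Σ[1to]≡sumFrom N F ⟩
  sumFrom 1 N F                ≡⟨ cong (λ l → sumFrom 1 l F) (sym (ℕ.m+[n∸m]≡n m≤N)) ⟩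
  sumFrom 1 (m ℕ.+ (N ∸ m)) F  ≡⟨ sumFrom-skip-zeros 1 m (N ∸ m) F below ⟩
  sumFrom (suc m) (N ∸ m) F    ≡⟨ sumFrom-cong (suc m) (N ∸ m) above ⟩
  sumFrom (suc m) (N ∸ m) G    ≡⟨ sym (Σ≡sumFrom (N ∸ m) G (trans (ℕ.+-suc (N ∸ m) m) (cong suc (ℕ.m∸n+n≡m m≤N)))) ⟩
  Σ[ suc m to N ] G            ∎
  where
  open ≡-Reasoning
  F G : ℕ → ℚ
  F j = ind≤ n (2 ℕ.* j) * invSq j * chainSum r j N invSq
  G j = invSq j * chainSum r j N invSq
  m≤N = ℕ.<⇒≤ m<N
  below : ∀ j → j < suc m → F j ≡ 0ℚ
  below j j≤m = trans (cong (λ s → s * invSq j * chainSum r j N invSq) (ind≤-no n≰2j))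
    (trans (cong (_* chainSum r j N invSq) (*-zeroˡ (invSq j))) (*-zeroˡ (chainSum r j N invSq)))
    where
    n≰2j : ¬ n ≤ 2 ℕ.* j
    n≰2j n≤2j = ℕ.<-irrefl refl (ℕ.≤-trans 2m<n (ℕ.≤-trans n≤2j
      (subst (2 ℕ.* j ≤_) (2*n≡dbl[n] m) (ℕ.*-monoʳ-≤ 2 (ℕ.≤-pred j≤m)))))
  above : ∀ j → suc m ≤ j → j < suc m ℕ.+ (N ∸ m) → F j ≡ G j
  above j m<j _ = trans (cong (λ s → s * invSq j * chainSum r j N invSq) (ind≤-yes n≤2j))
    (cong (_* chainSum r j N invSq) (*-identityˡ (invSq j)))
    where
    n≤2j : n ≤ 2 ℕ.* j
    n≤2j = ℕ.≤-trans n≤2m+2 (subst (_≤ 2 ℕ.* j) (2*n≡dbl[n] (suc m)) (ℕ.*-monoʳ-≤ 2 m<j))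

lhs-even : ∀ N r → lhs (suc (suc (dbl r))) N ≡ rhsEven (suc r) N
lhs-even N r = begin
  lhs (suc (suc (dbl r))) N                                 ≡⟨ lhs≡Σboundary ⟩
  sumFrom 1 N boundary                                      ≡⟨ sumFrom-cong 1 N boundary-eval ⟩
  sumFrom 1 N (λ c → ½ * (invSq c * chainSum r c N invSq))  ≡⟨ sumFrom-*ˡ 1 N ½ _ ⟩
  ½ * sumFrom 1 N (λ c → invSq c * chainSum r c N invSq)    ≡⟨ cong (½ *_) (sym (Σ[1to]≡sumFrom N _)) ⟩
  rhsEven (suc r) N                                         ∎
  where
  open ≡-Reasoning
  open Product N inv
  open Telescoping N (suc (dbl r))
  simplify : ∀ a x C → 0ℚ * a + ½ * x * C ≡ ½ * (x * C)
  simplify = solve-∀ ℚ-ring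
  boundary-eval : ∀ c → 1 ≤ c → c < 1 ℕ.+ N → boundary c ≡ ½ * (invSq c * chainSum r c N invSq)
  boundary-eval (suc c) _ (s≤s c<N) = begin
    boundary (suc c)
      ≡⟨ boundary-diag c<N ⟩
    P (suc c) (suc c) (suc (dbl r)) * i + ½ * invSq (suc c) * P (suc c) (suc c) (dbl r)
      ≡⟨ cong₂ (λ s t → s * i + ½ * invSq (suc c) * t) (P-diag-odd r c≤‴1+N) (P-diag-even r c≤‴1+N) ⟩
    0ℚ * i + ½ * invSq (suc c) * chainSum r (suc c) N invSq
      ≡⟨ simplify i (invSq (suc c)) _ ⟩
    ½ * (invSq (suc c) * chainSum r (suc c) N invSq)
      ∎
    where
    i = inv (suc (dbl c)) - inv (dbl (suc c))
    c≤‴1+N = ℕ.≤⇒≤‴ (ℕ.m≤n⇒m≤1+n c<N)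

lhs-odd : ∀ N r → lhs (suc (dbl r)) N ≡ rhsOdd r N
lhs-odd N r = begin
  lhs (suc (dbl r)) N                                 ≡⟨ lhs≡Σboundary ⟩
  sumFrom 1 N boundary                                ≡⟨ sumFrom-cong 1 N boundary-eval ⟩
  sumFrom 1 N (λ c → φ (ℕ.pred (dbl c)) + φ (dbl c))  ≡⟨ sym (sumFrom-dbl 0 N φ) ⟩
  sumFrom 1 (dbl N) φ                                 ≡⟨ sym (Σ[1to]≡sumFrom (dbl N) φ) ⟩
  Σ[ 1 to dbl N ] φ                                   ≡⟨ cong (λ n → Σ[ 1 to n ] φ) (sym (2*n≡dbl[n] N)) ⟩
  rhsOdd r N                                          ∎
  where
  open ≡-Reasoning
  open Product N inv
  open Telescoping N (dbl r)
  φ : ℕ → ℚ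
  φ n = sgn n * inv n * chainSumAbove r n N
  simplify : ∀ C i w h → C * (i - w) + h * 0ℚ ≡ 1ℚ * i * C + (- 1ℚ) * w * C
  simplify = solve-∀ ℚ-ring
  boundary-eval : ∀ c → 1 ≤ c → c < 1 ℕ.+ N → boundary c ≡ φ (ℕ.pred (dbl c)) + φ (dbl c)
  boundary-eval (suc c) _ (s≤s c<N) = begin
    boundary (suc c)
      ≡⟨ boundary-diag c<N ⟩
    P (suc c) (suc c) (dbl r) * (i - w) + ½ * invSq (suc c) * shift (P (suc c) (suc c)) (dbl r)
      ≡⟨ cong₂ (λ s t → s * (i - w) + ½ * invSq (suc c) * t) (P-diag-even r c≤‴1+N) (below r) ⟩
    C * (i - w) + ½ * invSq (suc c) * 0ℚ
      ≡⟨ simplify C i w (½ * invSq (suc c)) ⟩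
    1ℚ * i * C + (- 1ℚ) * w * C
      ≡⟨ cong₂ _+_
           (cong₂ (λ s t → s * i * t) (sym (sgn-odd c)) (sym (chainSumAbove-pair r c<N ℕ.≤-refl (ℕ.n≤1+n _))))
           (cong₂ (λ s t → s * w * t) (sym (sgn-even c)) (sym (chainSumAbove-pair r c<N (ℕ.n≤1+n _) ℕ.≤-refl))) ⟩
    φ (suc (dbl c)) + φ (dbl (suc c))
      ∎
    where
    i = inv (suc (dbl c))
    w = inv (dbl (suc c))
    C = chainSum r (suc c) N invSq
    c≤‴1+N = ℕ.≤⇒≤‴ (ℕ.m≤n⇒m≤1+n c<N)
    below : ∀ r → shift (P (suc c) (suc c)) (dbl r) ≡ 0ℚ
    below zero    = refl
    below (suc r) = P-diag-odd r c≤‴1+N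

theorem7p1 : (N k : ℕ) → 1 ≤ N → 1 ≤ k →
    ((r : ℕ) → k ≡ 2 ℕ.* r → lhs k N ≡ rhsEven r N) ×
    ((r : ℕ) → k ≡ 2 ℕ.* r ℕ.+ 1 → lhs k N ≡ rhsOdd r N)
theorem7p1 N zero    _ ()
theorem7p1 N (suc k) _ _  = even , odd
  where
  even : ∀ r → suc k ≡ 2 ℕ.* r → lhs (suc k) N ≡ rhsEven r N
  even zero    ()
  even (suc r) k≡2r = trans (cong (λ k → lhs k N) (trans k≡2r (2*n≡dbl[n] (suc r)))) (lhs-even N r)
  odd : ∀ r → suc k ≡ 2 ℕ.* r ℕ.+ 1 → lhs (suc k) N ≡ rhsOdd r N
  odd r k≡2r+1 = trans (cong (λ k → lhs k N) (trans k≡2r+1 (trans (ℕ.+-comm (2 ℕ.* r) 1) (cong suc (2*n≡dbl[n] r)))))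
    (lhs-odd N r)
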